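{- Let $I,J,I',J'$ be finite sets of positive integers (not necessarily forming reduced presentations), with $J,J'\ne\emptyset$. Then $\mathcal Q[I,J]\subseteq\mathcal Q[I',J']$ if and only if for every $i\in I$ with $i\neq1$ there is $i'\in I'$ with $i\mid i'$, and for every $j\in J$ there is $j'\in J'$ with $j\mid j'$.
   Context: A Wajsberg hoop is a commutative integral residuated lattice $\langle A,\vee,\wedge,\cdot,\rightarrow,1\rangle$ satisfying $(x\rightarrow y)\vee(y\rightarrow x)\approx1$, $x(x\rightarrow y)\approx y(y\rightarrow x)$ and $(x\rightarrow y)\rightarrow y\approx(y\rightarrow x)\rightarrow x$. For a totally ordered abelian group $\mathbf G$ with strong unit $u>0$, $\Gamma(\mathbf G,u)$ is the Wajsberg hoop on $\{a\in G:0\le a\le u\}$ with $a\cdot b=\max\{a+b-u,0\}$, $a\rightarrow b=\min\{u-a+b,u\}$, top $u$. $\mathbb Z\times_l\mathbb Z$ is the lexicographic product of two copies of $\mathbb Z$ (first coordinate dominant). $\mathbf{Ł}_n=\Gamma(\mathbb Z,n)$, $\mathbf{Ł}_{n,k}=\Gamma(\mathbb Z\times_l\mathbb Z,(n,k))$. $\mathcal Q[I,J]$ denotes the quasivariety generated by $\{\mathbf{Ł}_i:i\in I\}\cup\{\mathbf{Ł}_{j,1}:j\in J\}$. -}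

module Defs where

open import Data.Nat as ℕ using (ℕ)
open import Data.Integer as ℤ using (ℤ; +_)
open import Data.Bool using (Bool; true; false; T; if_then_else_; _∧_; _∨_; not)
open import Data.Product using (_×_; _,_; proj₁; proj₂)
open import Data.List using (List)
open import Data.List.Relation.Unary.All using (All)
open import Relation.Binary.PropositionalEquality using (_≡_)

data Term : Set where
  var  : ℕ → Term
  one  : Term
  join : Term → Term → Term
  meet : Term → Term → Term
  mul  : Term → Term → Term
  imp  : Term → Term → Term

Equation : Set
Equation = Term × Term

record QuasiIdentity : Set where
  constructor _⇒_
  field
    premises   : List Equation
    conclusion : Equation

record Algebra : Set₁ where
  field
    Carrier : Set
    _⊔ₐ_ _⊓ₐ_ _·ₐ_ _⇒ₐ_ : Carrier → Carrier → Carrier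
    1ₐ : Carrier

eval : (A : Algebra) → (ℕ → Algebra.Carrier A) → Term → Algebra.Carrier A
eval A v (var x)    = v x
eval A v one        = Algebra.1ₐ A
eval A v (join s t) = Algebra._⊔ₐ_ A (eval A v s) (eval A v t)
eval A v (meet s t) = Algebra._⊓ₐ_ A (eval A v s) (eval A v t)
eval A v (mul s t)  = Algebra._·ₐ_ A (eval A v s) (eval A v t)
eval A v (imp s t)  = Algebra._⇒ₐ_ A (eval A v s) (eval A v t)

_⊨_ : Algebra → QuasiIdentity → Set
A ⊨ (ps ⇒ (s , t)) =
  (v : ℕ → Algebra.Carrier A) →
  All (λ e → eval A v (proj₁ e) ≡ eval A v (proj₂ e)) ps →
  eval A v s ≡ eval A v t

-- Γ(G,u) for a totally ordered abelian group G with strong unit u.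
-- We only record the data needed to compute (the concrete instances
-- below are ℤ and ℤ ×ₗ ℤ).

record OrdGroup : Set₁ where
  field
    G     : Set
    _⊕_   : G → G → G
    _⊖_   : G → G → G
    𝟘     : G
    _≤ᵍ_  : G → G → Bool

module Γ (𝔾 : OrdGroup) (u : OrdGroup.G 𝔾) where
  open OrdGroup 𝔾

  max min : G → G → G
  max a b = if a ≤ᵍ b then b else a
  min a b = if a ≤ᵍ b then a else b

  ops : Algebra
  ops = record
    { Carrier = G
    ; _⊔ₐ_ = max
    ; _⊓ₐ_ = min
    ; _·ₐ_ = λ a b → max ((a ⊕ b) ⊖ u) 𝟘
    ; _⇒ₐ_ = λ a b → min ((u ⊖ a) ⊕ b) u
    ; 1ₐ   = u
    }

  InΓ : G → Set
  InΓ a = T ((𝟘 ≤ᵍ a) ∧ (a ≤ᵍ u))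

  -- Γ(G,u) ⊨ q : q holds for all valuations into [0,u]
  -- (the operations of Γ(G,u) are the restrictions of those above)
  sat : QuasiIdentity → Set
  sat (ps ⇒ (s , t)) =
    (v : ℕ → G) → (∀ x → InΓ (v x)) →
    All (λ e → eval ops v (proj₁ e) ≡ eval ops v (proj₂ e)) ps →
    eval ops v s ≡ eval ops v t

ℤ-ord : OrdGroup
ℤ-ord = record { G = ℤ ; _⊕_ = ℤ._+_ ; _⊖_ = ℤ._-_ ; 𝟘 = + 0 ; _≤ᵍ_ = ℤ._≤ᵇ_ }

_≡ᵇℤ_ : ℤ → ℤ → Bool
a ≡ᵇℤ b = (a ℤ.≤ᵇ b) ∧ (b ℤ.≤ᵇ a)

_<ᵇℤ_ : ℤ → ℤ → Bool
a <ᵇℤ b = (a ℤ.≤ᵇ b) ∧ not (b ℤ.≤ᵇ a)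

lex-ord : OrdGroup
lex-ord = record
  { G = ℤ × ℤ
  ; _⊕_ = λ { (a₁ , a₂) (b₁ , b₂) → (a₁ ℤ.+ b₁ , a₂ ℤ.+ b₂) }
  ; _⊖_ = λ { (a₁ , a₂) (b₁ , b₂) → (a₁ ℤ.- b₁ , a₂ ℤ.- b₂) }
  ; 𝟘 = (+ 0 , + 0)
  ; _≤ᵍ_ = λ { (a₁ , a₂) (b₁ , b₂) → (a₁ <ᵇℤ b₁) ∨ ((a₁ ≡ᵇℤ b₁) ∧ (a₂ ℤ.≤ᵇ b₂)) }
  }

Ł-sat : ℕ → QuasiIdentity → Set
Ł-sat n = Γ.sat ℤ-ord (+ n)

Ł1-sat : ℕ → QuasiIdentity → Set
Ł1-sat n = Γ.sat lex-ord (+ n , + 1)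

-- Q[I,J]: the quasivariety generated by {Ł_i : i ∈ I} ∪ {Ł_{j,1} : j ∈ J},
-- i.e. the class of all algebras satisfying every quasi-identity valid
-- in all the generators.

ValidIn : List ℕ → List ℕ → QuasiIdentity → Set
ValidIn I J q = All (λ i → Ł-sat i q) I × All (λ j → Ł1-sat j q) J

Q[_,_] : List ℕ → List ℕ → Algebra → Set
Q[ I , J ] A = (q : QuasiIdentity) → ValidIn I J q → A ⊨ q

_⊆Q_ : (Algebra → Set) → (Algebra → Set) → Set₁
K ⊆Q K' = (A : Algebra) → K A → K' A

-- A divisibility i ∣ i' (resp. j ∣ j') gives an embedding of ordered groups
-- a ↦ (i'/i)a of ℤ (resp. (a , b) ↦ ((j'/j)a , b) of ℤ ×ₗ ℤ) preserving the strong unit, hence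
-- Ł_i ↪ Ł_i' (resp. Ł_{j,1} ↪ Ł_{j',1}); and Ł_1 embeds into every Ł_{j',1} by a ↦ (j'a , a).
-- Embeddings reflect quasi-identities, so every generator of Q[I,J] lies in Q[I',J'].
--
-- In Γ(ℤ ×ₗ ℤ, u) the power x^k is max(u − k(u − x), 0).  The premises of partQI n
-- force x = u or u = (n+1)(u − x); so for i ≥ 2, partQI (i − 1) fails in Ł_i (at x = i − 1) but
-- holds in every Ł_i' with i ∤ i' and in every Ł_{j',1}.  With δ = x^j → x^(j+1), the premises
-- of residueQI j N force δ = 1 unless u = g + j(u − x) for some g = x^j > 0 with (N+1)g ≤ u.
-- Once N bounds I' and J' this cannot happen in any Ł_i', nor in Ł_{j',1} unless j ∣ j', while
-- Ł_{j,1} refutes residueQI j N at x = (j − 1 , 1), where g = (0 , 1) is infinitesimal.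

module Submission where

open import Defs
open import Data.Nat as ℕ using (ℕ; zero; suc; s≤s; z≤n; _<_)
import Data.Nat.Properties as ℕP
open import Data.Nat.Divisibility using (_∣_; _∣?_; divides; ∣1⇒≡1)
open import Data.Nat.ListAction using (sum)
open import Data.Integer as ℤ using (ℤ; +_; +[1+_]; +≤+; +<+)
import Data.Integer.Properties as ℤP
open import Data.Integer.Tactic.RingSolver using (solve-∀)
open import Data.Bool using (Bool; true; false; T; if_then_else_; _∧_)
open import Data.Bool.Properties using (if-float; T-∧; T-irrelevant)
open import Data.Empty using (⊥; ⊥-elim)
open import Data.Product using (Σ; _×_; _,_; proj₁; proj₂)
open import Data.Product.Properties using (≡-dec; Σ-≡,≡→≡)
open import Data.Product.Relation.Binary.Lex.Strict using (×-Lex; ×-transitive; ×-antisymmetric; ×-total₂)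
open import Data.Product.Relation.Binary.Pointwise.NonDependent using (≡×≡⇒≡)
open import Data.Sum as Sum using (_⊎_; inj₁; inj₂)
open import Data.List using (List; []; _∷_)
open import Data.List.Relation.Unary.All as All using (All; []; _∷_)
open import Data.List.Relation.Unary.All.Properties using (¬Any⇒All¬)
open import Data.List.Relation.Unary.Any using (here; there; any?)
open import Data.List.Membership.Propositional using (_∈_; find)
open import Function using (_∘_; id)
open import Function.Bundles using (_⇔_; mk⇔; Equivalence)
open import Relation.Binary.PropositionalEquality
open import Relation.Nullary using (¬_; Dec; yes; no)
open ≡-Reasoning

-- The lexicographic order on ℤ × ℤ

L : Set
L = ℤ × ℤ

0L : L
0L = + 0 , + 0

infixl 6 _+L_ _-L_
_+L_ _-L_ : L → L → L
_+L_ = OrdGroup._⊕_ lex-ord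
_-L_ = OrdGroup._⊖_ lex-ord

_≤ᴸ_ : L → L → Bool
_≤ᴸ_ = OrdGroup._≤ᵍ_ lex-ord

infix 4 _≼_
_≼_ : L → L → Set
_≼_ = ×-Lex _≡_ ℤ._<_ ℤ._≤_

≼-refl : ∀ {p} → p ≼ p
≼-refl = inj₂ (refl , ℤP.≤-refl)

≼-trans : ∀ {p q r} → p ≼ q → q ≼ r → p ≼ r
≼-trans = ×-transitive {_≈₁_ = _≡_} {_<₁_ = ℤ._<_} {_<₂_ = ℤ._≤_}
  isEquivalence (resp₂ ℤ._<_) ℤP.<-trans ℤP.≤-trans

≼-antisym : ∀ {p q} → p ≼ q → q ≼ p → p ≡ q
≼-antisym p≼q q≼p =
  ≡×≡⇒≡ (×-antisymmetric {_≈₁_ = _≡_} {_<₁_ = ℤ._<_} {_≈₂_ = _≡_} {_<₂_ = ℤ._≤_}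
           sym ℤP.<-irrefl ℤP.<-asym ℤP.≤-antisym p≼q q≼p)

≼-total : ∀ p q → p ≼ q ⊎ q ≼ p
≼-total = ×-total₂ {_≈₁_ = _≡_} {_<₁_ = ℤ._<_} {_<₂_ = ℤ._≤_} sym ℤP.<-cmp ℤP.≤-total

≼⇒fst≤ : ∀ {p q} → p ≼ q → proj₁ p ℤ.≤ proj₁ q
≼⇒fst≤ (inj₁ p₁<q₁)      = ℤP.<⇒≤ p₁<q₁
≼⇒fst≤ (inj₂ (p₁≡q₁ , _)) = ℤP.≤-reflexive p₁≡q₁

≤ᴸ⇔≼ : ∀ p q → T (p ≤ᴸ q) ⇔ p ≼ q
≤ᴸ⇔≼ (a₁ , a₂) (b₁ , b₂) with a₁ ℤ.≤ᵇ b₁ in a₁≤b₁ | b₁ ℤ.≤ᵇ a₁ in b₁≤a₁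
... | false | _     = mk⇔ (λ ()) (λ a≼b → subst T a₁≤b₁ (ℤP.≤⇒≤ᵇ (≼⇒fst≤ a≼b)))
... | true  | false = mk⇔ (λ _ → inj₁ (ℤP.≰⇒> (subst T b₁≤a₁ ∘ ℤP.≤⇒≤ᵇ))) _
... | true  | true  = mk⇔
  (λ a₂≤b₂ → inj₂ (ℤP.≤-antisym (≤ᵇ-true a₁≤b₁) (≤ᵇ-true b₁≤a₁) , ℤP.≤ᵇ⇒≤ a₂≤b₂))
  λ { (inj₁ a₁<b₁)       → ⊥-elim (ℤP.<⇒≱ a₁<b₁ (≤ᵇ-true b₁≤a₁))
    ; (inj₂ (_ , a₂≤b₂)) → ℤP.≤⇒≤ᵇ a₂≤b₂ }
  where
  ≤ᵇ-true : ∀ {a b} → (a ℤ.≤ᵇ b) ≡ true → a ℤ.≤ b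
  ≤ᵇ-true eq = ℤP.≤ᵇ⇒≤ (subst T (sym eq) _)

≤ᴸ⇒≼ : ∀ {p q} → T (p ≤ᴸ q) → p ≼ q
≤ᴸ⇒≼ = Equivalence.to (≤ᴸ⇔≼ _ _)

≼⇒≤ᴸ : ∀ {p q} → p ≼ q → T (p ≤ᴸ q)
≼⇒≤ᴸ = Equivalence.from (≤ᴸ⇔≼ _ _)

≰ᴸ⇒≽ : ∀ {p q} → ¬ T (p ≤ᴸ q) → q ≼ p
≰ᴸ⇒≽ {p} {q} p≰q with ≼-total p q
... | inj₁ p≼q = ⊥-elim (p≰q (≼⇒≤ᴸ p≼q))
... | inj₂ q≼p = q≼p

≤×≤⇒≼ : ∀ {p q} → proj₁ p ℤ.≤ proj₁ q → proj₂ p ℤ.≤ proj₂ q → p ≼ q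
≤×≤⇒≼ {p} {q} p₁≤q₁ p₂≤q₂ with proj₁ p ℤ.≟ proj₁ q
... | yes p₁≡q₁ = inj₂ (p₁≡q₁ , p₂≤q₂)
... | no  p₁≢q₁ = inj₁ (ℤP.≤∧≢⇒< p₁≤q₁ p₁≢q₁)

0≼+,+ : ∀ m n → 0L ≼ (+ m , + n)
0≼+,+ m n = ≤×≤⇒≼ (+≤+ z≤n) (+≤+ z≤n)

-- Embeddings reflect quasi-identities

Satisfies : (A : Algebra) → (ℕ → Algebra.Carrier A) → Equation → Set
Satisfies A v (s , t) = eval A v s ≡ eval A v t

Holds : (A : Algebra) → (ℕ → Algebra.Carrier A) → QuasiIdentity → Set
Holds A v (ps ⇒ e) = All (Satisfies A v) ps → Satisfies A v e

record Embedding (A B : Algebra) : Set where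
  field
    ⟦_⟧       : Algebra.Carrier A → Algebra.Carrier B
    injective : ∀ {a b} → ⟦ a ⟧ ≡ ⟦ b ⟧ → a ≡ b
    ⟦⊔⟧ : ∀ a b → ⟦ Algebra._⊔ₐ_ A a b ⟧ ≡ Algebra._⊔ₐ_ B ⟦ a ⟧ ⟦ b ⟧
    ⟦⊓⟧ : ∀ a b → ⟦ Algebra._⊓ₐ_ A a b ⟧ ≡ Algebra._⊓ₐ_ B ⟦ a ⟧ ⟦ b ⟧
    ⟦·⟧ : ∀ a b → ⟦ Algebra._·ₐ_ A a b ⟧ ≡ Algebra._·ₐ_ B ⟦ a ⟧ ⟦ b ⟧
    ⟦⇒⟧ : ∀ a b → ⟦ Algebra._⇒ₐ_ A a b ⟧ ≡ Algebra._⇒ₐ_ B ⟦ a ⟧ ⟦ b ⟧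
    ⟦1⟧ : ⟦ Algebra.1ₐ A ⟧ ≡ Algebra.1ₐ B

module _ {A B : Algebra} (h : Embedding A B) where
  open Embedding h

  eval-⟦⟧ : ∀ v t → ⟦ eval A v t ⟧ ≡ eval B (⟦_⟧ ∘ v) t
  eval-⟦⟧ v (var x)    = refl
  eval-⟦⟧ v one        = ⟦1⟧
  eval-⟦⟧ v (join s t) = trans (⟦⊔⟧ _ _) (cong₂ (Algebra._⊔ₐ_ B) (eval-⟦⟧ v s) (eval-⟦⟧ v t))
  eval-⟦⟧ v (meet s t) = trans (⟦⊓⟧ _ _) (cong₂ (Algebra._⊓ₐ_ B) (eval-⟦⟧ v s) (eval-⟦⟧ v t))
  eval-⟦⟧ v (mul s t)  = trans (⟦·⟧ _ _) (cong₂ (Algebra._·ₐ_ B) (eval-⟦⟧ v s) (eval-⟦⟧ v t))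
  eval-⟦⟧ v (imp s t)  = trans (⟦⇒⟧ _ _) (cong₂ (Algebra._⇒ₐ_ B) (eval-⟦⟧ v s) (eval-⟦⟧ v t))

  satisfies-⟦⟧ : ∀ v e → Satisfies A v e ⇔ Satisfies B (⟦_⟧ ∘ v) e
  satisfies-⟦⟧ v (s , t) = mk⇔
    (λ eq → trans (sym (eval-⟦⟧ v s)) (trans (cong ⟦_⟧ eq) (eval-⟦⟧ v t)))
    (λ eq → injective (trans (eval-⟦⟧ v s) (trans eq (sym (eval-⟦⟧ v t)))))

  holds-⟦⟧ : ∀ v q → Holds A v q ⇔ Holds B (⟦_⟧ ∘ v) q
  holds-⟦⟧ v (ps ⇒ e) = mk⇔
    (λ h → to (satisfies-⟦⟧ v e) ∘ h ∘ All.map (λ {e'} → from (satisfies-⟦⟧ v e')))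
    (λ h → from (satisfies-⟦⟧ v e) ∘ h ∘ All.map (λ {e'} → to (satisfies-⟦⟧ v e')))
    where open Equivalence

record OrdEmbedding (𝔾 𝔾' : OrdGroup) : Set where
  field
    φ         : OrdGroup.G 𝔾 → OrdGroup.G 𝔾'
    injective : ∀ {a b} → φ a ≡ φ b → a ≡ b
    φ-⊕ : ∀ a b → φ (OrdGroup._⊕_ 𝔾 a b) ≡ OrdGroup._⊕_ 𝔾' (φ a) (φ b)
    φ-⊖ : ∀ a b → φ (OrdGroup._⊖_ 𝔾 a b) ≡ OrdGroup._⊖_ 𝔾' (φ a) (φ b)
    φ-𝟘 : φ (OrdGroup.𝟘 𝔾) ≡ OrdGroup.𝟘 𝔾'
    φ-≤ : ∀ a b → OrdGroup._≤ᵍ_ 𝔾' (φ a) (φ b) ≡ OrdGroup._≤ᵍ_ 𝔾 a b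

module _ {𝔾 𝔾' : OrdGroup} (e : OrdEmbedding 𝔾 𝔾') (u : OrdGroup.G 𝔾) where
  open OrdEmbedding e
  open OrdGroup 𝔾
  private module G' = OrdGroup 𝔾'

  φ-if : ∀ a b x y → φ (if a ≤ᵍ b then x else y) ≡ (if φ a G'.≤ᵍ φ b then φ x else φ y)
  φ-if a b x y = trans (if-float φ (a ≤ᵍ b)) (cong (λ c → if c then φ x else φ y) (sym (φ-≤ a b)))

  Γ-embedding : Embedding (Γ.ops 𝔾 u) (Γ.ops 𝔾' (φ u))
  Γ-embedding = record
    { ⟦_⟧ = φ
    ; injective = injective
    ; ⟦⊔⟧ = λ a b → φ-if a b b a
    ; ⟦⊓⟧ = λ a b → φ-if a b a b
    ; ⟦·⟧ = λ a b → trans (φ-if _ 𝟘 𝟘 _)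
        (cong₂ (λ x y → if x G'.≤ᵍ y then y else x)
          (trans (φ-⊖ _ u) (cong (G'._⊖ φ u) (φ-⊕ a b))) φ-𝟘)
    ; ⟦⇒⟧ = λ a b → trans (φ-if _ u _ u)
        (cong (λ x → if x G'.≤ᵍ φ u then x else φ u)
          (trans (φ-⊕ _ b) (cong (G'._⊕ φ b) (φ-⊖ u a))))
    ; ⟦1⟧ = refl
    }

  InΓ-φ : ∀ a → Γ.InΓ 𝔾 u a ⇔ Γ.InΓ 𝔾' (φ u) (φ a)
  InΓ-φ a = mk⇔ (subst T (sym flag)) (subst T flag)
    where
    flag : (G'.𝟘 G'.≤ᵍ φ a ∧ φ a G'.≤ᵍ φ u) ≡ (𝟘 ≤ᵍ a ∧ a ≤ᵍ u)
    flag = cong₂ _∧_ (trans (cong (G'._≤ᵍ φ a) (sym φ-𝟘)) (φ-≤ 𝟘 a)) (φ-≤ a u)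

  -- For when only valuations into the image are under control: Γ(ℤ, i) embeds in
  -- Γ(ℤ ×ₗ ℤ, (i , 0)) via ι, but the latter satisfies fewer quasi-identities.
  sat-from-image : ∀ q → (∀ v → (∀ x → Γ.InΓ 𝔾 u (v x)) → Holds (Γ.ops 𝔾' (φ u)) (φ ∘ v) q) →
                   Γ.sat 𝔾 u q
  sat-from-image q h v v∈Γ = Equivalence.from (holds-⟦⟧ Γ-embedding v q) (h v v∈Γ)

  sat-reflect : ∀ q → Γ.sat 𝔾' (φ u) q → Γ.sat 𝔾 u q
  sat-reflect q sat' = sat-from-image q λ v v∈Γ →
    sat' (φ ∘ v) (λ x → Equivalence.to (InΓ-φ (v x)) (v∈Γ x))

-- Sufficiency of the divisibility conditions

T-ext : ∀ {x y} → (T x → T y) → (T y → T x) → x ≡ y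
T-ext {false} {false} _ _ = refl
T-ext {false} {true}  _ g = ⊥-elim (g _)
T-ext {true}  {false} f _ = ⊥-elim (f _)
T-ext {true}  {true}  _ _ = refl

*-distribˡ-minus : ∀ k a b → k ℤ.* (a ℤ.- b) ≡ k ℤ.* a ℤ.- k ℤ.* b
*-distribˡ-minus k a b =
  trans (ℤP.*-distribˡ-+ k a (ℤ.- b)) (cong (λ x → k ℤ.* a ℤ.+ x) (sym (ℤP.neg-distribʳ-* k b)))

≤ᵇ≡≤ᵇ : ∀ {a b c d} → a ℤ.≤ b ⇔ c ℤ.≤ d → (a ℤ.≤ᵇ b) ≡ (c ℤ.≤ᵇ d)
≤ᵇ≡≤ᵇ h = T-ext (ℤP.≤⇒≤ᵇ ∘ to h ∘ ℤP.≤ᵇ⇒≤) (ℤP.≤⇒≤ᵇ ∘ from h ∘ ℤP.≤ᵇ⇒≤)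
  where open Equivalence

≤ᴸ≡≤ᵇ : ∀ {p q a b} → p ≼ q ⇔ a ℤ.≤ b → (p ≤ᴸ q) ≡ (a ℤ.≤ᵇ b)
≤ᴸ≡≤ᵇ h = T-ext (ℤP.≤⇒≤ᵇ ∘ to h ∘ ≤ᴸ⇒≼) (≼⇒≤ᴸ ∘ from h ∘ ℤP.≤ᵇ⇒≤)
  where open Equivalence

≤ᴸ≡≤ᴸ : ∀ {p q p' q'} → p ≼ q ⇔ p' ≼ q' → (p ≤ᴸ q) ≡ (p' ≤ᴸ q')
≤ᴸ≡≤ᴸ h = T-ext (≼⇒≤ᴸ ∘ to h ∘ ≤ᴸ⇒≼) (≼⇒≤ᴸ ∘ from h ∘ ≤ᴸ⇒≼)
  where open Equivalence

module _ (k : ℕ) where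

  +[1+k]*-≤ : ∀ a b → +[1+ k ] ℤ.* a ℤ.≤ +[1+ k ] ℤ.* b ⇔ a ℤ.≤ b
  +[1+k]*-≤ a b = mk⇔ (ℤP.*-cancelˡ-≤-pos a b +[1+ k ]) (ℤP.*-monoˡ-≤-nonNeg +[1+ k ])

  graph-≼ : ∀ a b → (+[1+ k ] ℤ.* a , a) ≼ (+[1+ k ] ℤ.* b , b) ⇔ a ℤ.≤ b
  graph-≼ a b = mk⇔ to from
    where
    to : (+[1+ k ] ℤ.* a , a) ≼ (+[1+ k ] ℤ.* b , b) → a ℤ.≤ b
    to (inj₁ ka<kb)       = ℤP.<⇒≤ (ℤP.*-cancelˡ-<-nonNeg +[1+ k ] ka<kb)
    to (inj₂ (_ , a≤b))   = a≤b
    from : a ℤ.≤ b → (+[1+ k ] ℤ.* a , a) ≼ (+[1+ k ] ℤ.* b , b)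
    from a≤b with a ℤ.≟ b
    ... | yes refl = ≼-refl
    ... | no a≢b   = inj₁ (ℤP.*-monoˡ-<-pos +[1+ k ] (ℤP.≤∧≢⇒< a≤b a≢b))

  scaleFst-≼ : ∀ p q → (+[1+ k ] ℤ.* proj₁ p , proj₂ p) ≼ (+[1+ k ] ℤ.* proj₁ q , proj₂ q) ⇔ p ≼ q
  scaleFst-≼ p q = mk⇔ to from
    where
    to : (+[1+ k ] ℤ.* proj₁ p , proj₂ p) ≼ (+[1+ k ] ℤ.* proj₁ q , proj₂ q) → p ≼ q
    to (inj₁ kp<kq)        = inj₁ (ℤP.*-cancelˡ-<-nonNeg +[1+ k ] kp<kq)
    to (inj₂ (kp≡kq , ≤₂)) = inj₂ (ℤP.*-cancelˡ-≡ +[1+ k ] _ _ kp≡kq , ≤₂)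
    from : p ≼ q → (+[1+ k ] ℤ.* proj₁ p , proj₂ p) ≼ (+[1+ k ] ℤ.* proj₁ q , proj₂ q)
    from (inj₁ p<q)         = inj₁ (ℤP.*-monoˡ-<-pos +[1+ k ] p<q)
    from (inj₂ (refl , ≤₂)) = inj₂ (refl , ≤₂)

  scale : OrdEmbedding ℤ-ord ℤ-ord
  scale = record
    { φ = +[1+ k ] ℤ.*_
    ; injective = ℤP.*-cancelˡ-≡ +[1+ k ] _ _
    ; φ-⊕ = ℤP.*-distribˡ-+ +[1+ k ]
    ; φ-⊖ = *-distribˡ-minus +[1+ k ]
    ; φ-𝟘 = ℤP.*-zeroʳ +[1+ k ]
    ; φ-≤ = λ a b → ≤ᵇ≡≤ᵇ (+[1+k]*-≤ a b)
    }

  graph : OrdEmbedding ℤ-ord lex-ord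
  graph = record
    { φ = λ a → +[1+ k ] ℤ.* a , a
    ; injective = cong proj₂
    ; φ-⊕ = λ a b → cong (_, a ℤ.+ b) (ℤP.*-distribˡ-+ +[1+ k ] a b)
    ; φ-⊖ = λ a b → cong (_, a ℤ.- b) (*-distribˡ-minus +[1+ k ] a b)
    ; φ-𝟘 = cong (_, + 0) (ℤP.*-zeroʳ +[1+ k ])
    ; φ-≤ = λ a b → ≤ᴸ≡≤ᵇ (graph-≼ a b)
    }

  scaleFst : OrdEmbedding lex-ord lex-ord
  scaleFst = record
    { φ = λ p → +[1+ k ] ℤ.* proj₁ p , proj₂ p
    ; injective = λ eq → cong₂ _,_ (ℤP.*-cancelˡ-≡ +[1+ k ] _ _ (cong proj₁ eq)) (cong proj₂ eq)
    ; φ-⊕ = λ p q → cong (_, proj₂ p ℤ.+ proj₂ q) (ℤP.*-distribˡ-+ +[1+ k ] (proj₁ p) (proj₁ q))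
    ; φ-⊖ = λ p q → cong (_, proj₂ p ℤ.- proj₂ q) (*-distribˡ-minus +[1+ k ] (proj₁ p) (proj₁ q))
    ; φ-𝟘 = cong (_, + 0) (ℤP.*-zeroʳ +[1+ k ])
    ; φ-≤ = λ p q → ≤ᴸ≡≤ᴸ (scaleFst-≼ p q)
    }

ι-≼ : ∀ a b → (a , + 0) ≼ (b , + 0) ⇔ a ℤ.≤ b
ι-≼ a b = mk⇔ to from
  where
  to : (a , + 0) ≼ (b , + 0) → a ℤ.≤ b
  to (inj₁ a<b)        = ℤP.<⇒≤ a<b
  to (inj₂ (refl , _)) = ℤP.≤-refl
  from : a ℤ.≤ b → (a , + 0) ≼ (b , + 0)
  from a≤b with a ℤ.≟ b
  ... | yes refl = ≼-refl
  ... | no a≢b   = inj₁ (ℤP.≤∧≢⇒< a≤b a≢b)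

ι : OrdEmbedding ℤ-ord lex-ord
ι = record
  { φ = _, + 0
  ; injective = cong proj₁
  ; φ-⊕ = λ _ _ → refl
  ; φ-⊖ = λ _ _ → refl
  ; φ-𝟘 = refl
  ; φ-≤ = λ a b → ≤ᴸ≡≤ᵇ (ι-≼ a b)
  }

∣⇒≡+[1+k]* : ∀ {i i'} → 0 ℕ.< i' → i ∣ i' → Σ ℕ λ k → + i' ≡ +[1+ k ] ℤ.* + i
∣⇒≡+[1+k]* {i' = suc _} _ (divides zero ())
∣⇒≡+[1+k]* {i} _ (divides (suc k) eq) = k , trans (cong +_ eq) (ℤP.pos-* (suc k) i)

Ł-sat-∣ : ∀ {i i'} q → 0 ℕ.< i' → i ∣ i' → Ł-sat i' q → Ł-sat i q
Ł-sat-∣ {i} q 0<i' i∣i' sat with ∣⇒≡+[1+k]* 0<i' i∣i'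
... | k , eq = sat-reflect (scale k) (+ i) q (subst (λ w → Γ.sat ℤ-ord w q) eq sat)

Ł1-sat-∣ : ∀ {j j'} q → 0 ℕ.< j' → j ∣ j' → Ł1-sat j' q → Ł1-sat j q
Ł1-sat-∣ {j} q 0<j' j∣j' sat with ∣⇒≡+[1+k]* 0<j' j∣j'
... | k , eq = sat-reflect (scaleFst k) (+ j , + 1) q (subst (λ w → Γ.sat lex-ord (w , + 1) q) eq sat)

Ł1-sat⇒Ł-sat-1 : ∀ {j} q → 0 ℕ.< j → Ł1-sat j q → Ł-sat 1 q
Ł1-sat⇒Ł-sat-1 {suc k} q _ sat = sat-reflect (graph k) (+ 1) q
  (subst (λ w → Γ.sat lex-ord (w , + 1) q) (sym (ℤP.*-identityʳ +[1+ k ])) sat)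

Ł1-sat-any⇒Ł-sat-1 : ∀ {J} q → J ≢ [] → All (0 ℕ.<_) J → All (λ j → Ł1-sat j q) J → Ł-sat 1 q
Ł1-sat-any⇒Ł-sat-1 {[]}    q J≢[] _         _         = ⊥-elim (J≢[] refl)
Ł1-sat-any⇒Ł-sat-1 {_ ∷ _} q _    (0<j ∷ _) (sat ∷ _) = Ł1-sat⇒Ł-sat-1 q 0<j sat

divisibility⇒⊆Q : ∀ I J I' J' → All (0 ℕ.<_) I' → All (0 ℕ.<_) J' → J' ≢ [] →
  ((i : ℕ) → i ∈ I → i ≢ 1 → Σ ℕ (λ i' → i' ∈ I' × i ∣ i')) →
  ((j : ℕ) → j ∈ J → Σ ℕ (λ j' → j' ∈ J' × j ∣ j')) →
  Q[ I , J ] ⊆Q Q[ I' , J' ]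
divisibility⇒⊆Q I J I' J' 0<I' 0<J' J'≢[] I∣I' J∣J' A A∈Q q (q∈I' , q∈J') =
  A∈Q q (All.tabulate (λ {i} → Ł-valid i) , All.tabulate (λ {j} → Ł1-valid j))
  where
  Ł-valid : ∀ i → i ∈ I → Ł-sat i q
  Ł-valid i i∈I with i ℕ.≟ 1
  ... | yes refl = Ł1-sat-any⇒Ł-sat-1 q J'≢[] 0<J' q∈J'
  ... | no i≢1 with I∣I' i i∈I i≢1
  ...   | i' , i'∈I' , i∣i' = Ł-sat-∣ q (All.lookup 0<I' i'∈I') i∣i' (All.lookup q∈I' i'∈I')

  Ł1-valid : ∀ j → j ∈ J → Ł1-sat j q
  Ł1-valid j j∈J with J∣J' j j∈J
  ... | j' , j'∈J' , j∣j' = Ł1-sat-∣ q (All.lookup 0<J' j'∈J') j∣j' (All.lookup q∈J' j'∈J')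

-- Arithmetic of Γ(ℤ ×ₗ ℤ, u)

+L-identityˡ : ∀ p → 0L +L p ≡ p
+L-identityˡ (a₁ , a₂) = cong₂ _,_ (ℤP.+-identityˡ a₁) (ℤP.+-identityˡ a₂)

+L-identityʳ : ∀ p → p +L 0L ≡ p
+L-identityʳ (a₁ , a₂) = cong₂ _,_ (ℤP.+-identityʳ a₁) (ℤP.+-identityʳ a₂)

-L-identityʳ : ∀ p → p -L 0L ≡ p
-L-identityʳ = +L-identityʳ

p-p≡0 : ∀ p → p -L p ≡ 0L
p-p≡0 (a₁ , a₂) = cong₂ _,_ (ℤP.+-inverseʳ a₁) (ℤP.+-inverseʳ a₂)

[p-q]+q≡p : ∀ p q → (p -L q) +L q ≡ p
[p-q]+q≡p (a₁ , a₂) (b₁ , b₂) = cong₂ _,_ (lemma a₁ b₁) (lemma a₂ b₂)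
  where
  lemma : ∀ a b → (a ℤ.- b) ℤ.+ b ≡ a
  lemma = solve-∀

[p+q]-q≡p : ∀ p q → (p +L q) -L q ≡ p
[p+q]-q≡p (a₁ , a₂) (b₁ , b₂) = cong₂ _,_ (lemma a₁ b₁) (lemma a₂ b₂)
  where
  lemma : ∀ a b → (a ℤ.+ b) ℤ.- b ≡ a
  lemma = solve-∀

p-[p-q]≡q : ∀ p q → p -L (p -L q) ≡ q
p-[p-q]≡q (a₁ , a₂) (b₁ , b₂) = cong₂ _,_ (lemma a₁ b₁) (lemma a₂ b₂)
  where
  lemma : ∀ a b → a ℤ.- (a ℤ.- b) ≡ b
  lemma = solve-∀

infixl 7 _·L_
_·L_ : ℕ → L → L
k ·L (a₁ , a₂) = + k ℤ.* a₁ , + k ℤ.* a₂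

·L-zeroʳ : ∀ k → k ·L 0L ≡ 0L
·L-zeroʳ k = cong₂ _,_ (ℤP.*-zeroʳ (+ k)) (ℤP.*-zeroʳ (+ k))

suc-·L : ∀ k c → suc k ·L c ≡ c +L k ·L c
suc-·L k (c₁ , c₂) = cong₂ _,_ (ℤP.suc-* (+ k) c₁) (ℤP.suc-* (+ k) c₂)

[k+1]c-kc≡c : ∀ k c → suc k ·L c -L k ·L c ≡ c
[k+1]c-kc≡c k c = trans (cong (_-L k ·L c) (suc-·L k c)) ([p+q]-q≡p c (k ·L c))

u-[k+1]c≡u-kc-c : ∀ u k c → u -L suc k ·L c ≡ (u -L k ·L c) -L c
u-[k+1]c≡u-kc-c (u₁ , u₂) k (c₁ , c₂) = cong₂ _,_ (lemma u₁ (+ k) c₁) (lemma u₂ (+ k) c₂)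
  where
  lemma : ∀ u k c → u ℤ.- (+ 1 ℤ.+ k) ℤ.* c ≡ (u ℤ.- k ℤ.* c) ℤ.- c
  lemma = solve-∀

u-kc≡c⇒u≡[k+1]c : ∀ u k c → u -L k ·L c ≡ c → u ≡ suc k ·L c
u-kc≡c⇒u≡[k+1]c u k c eq = begin
  u                       ≡⟨ [p-q]+q≡p u (k ·L c) ⟨
  (u -L k ·L c) +L k ·L c ≡⟨ cong (_+L k ·L c) eq ⟩
  c +L k ·L c             ≡⟨ suc-·L k c ⟨
  suc k ·L c              ∎

[u-[u-Ng]]+[u-[N+1]g]≡u-g : ∀ u g N → (u -L (u -L N ·L g)) +L (u -L suc N ·L g) ≡ u -L g
[u-[u-Ng]]+[u-[N+1]g]≡u-g (u₁ , u₂) (g₁ , g₂) N = cong₂ _,_ (lemma u₁ g₁ (+ N)) (lemma u₂ g₂ (+ N))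
  where
  lemma : ∀ u g N → (u ℤ.- (u ℤ.- N ℤ.* g)) ℤ.+ (u ℤ.- (+ 1 ℤ.+ N) ℤ.* g) ≡ u ℤ.- g
  lemma = solve-∀

[a+[u-kc]]-u≡u-[k+1]c : ∀ u a k → (a +L (u -L k ·L (u -L a))) -L u ≡ u -L suc k ·L (u -L a)
[a+[u-kc]]-u≡u-[k+1]c (u₁ , u₂) (a₁ , a₂) k = cong₂ _,_ (lemma u₁ a₁ (+ k)) (lemma u₂ a₂ (+ k))
  where
  lemma : ∀ u a k → (a ℤ.+ (u ℤ.- k ℤ.* (u ℤ.- a))) ℤ.- u ≡ u ℤ.- (+ 1 ℤ.+ k) ℤ.* (u ℤ.- a)
  lemma = solve-∀

+L-mono-≼ : ∀ {p q r s} → p ≼ q → r ≼ s → p +L r ≼ q +L s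
+L-mono-≼     (inj₁ p₁<q₁)          r≼s                   = inj₁ (ℤP.+-mono-<-≤ p₁<q₁ (≼⇒fst≤ r≼s))
+L-mono-≼ {p} (inj₂ (refl , _))     (inj₁ r₁<s₁)          = inj₁ (ℤP.+-monoʳ-< (proj₁ p) r₁<s₁)
+L-mono-≼     (inj₂ (refl , p₂≤q₂)) (inj₂ (refl , r₂≤s₂)) = inj₂ (refl , ℤP.+-mono-≤ p₂≤q₂ r₂≤s₂)

≼⇒0≼- : ∀ {p q} → p ≼ q → 0L ≼ q -L p
≼⇒0≼- {p} {q} p≼q =
  subst (_≼ q -L p) (p-p≡0 p) (+L-mono-≼ p≼q (≼-refl {ℤ.- proj₁ p , ℤ.- proj₂ p}))

≼⇒-≼0 : ∀ {p q} → p ≼ q → p -L q ≼ 0L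
≼⇒-≼0 {p} {q} p≼q =
  subst (p -L q ≼_) (p-p≡0 q) (+L-mono-≼ p≼q (≼-refl {ℤ.- proj₁ q , ℤ.- proj₂ q}))

0≼-⇒≼ : ∀ {p q} → 0L ≼ q -L p → p ≼ q
0≼-⇒≼ {p} {q} 0≼q-p = subst₂ _≼_ (+L-identityˡ p) ([p-q]+q≡p q p) (+L-mono-≼ 0≼q-p (≼-refl {p}))

p-c≼p : ∀ p {c} → 0L ≼ c → p -L c ≼ p
p-c≼p p {c} 0≼c = subst₂ _≼_ (+L-identityʳ (p -L c)) ([p-q]+q≡p p c) (+L-mono-≼ (≼-refl {p -L c}) 0≼c)

_≟L_ : (p q : L) → Dec (p ≡ q)
_≟L_ = ≡-dec ℤ._≟_ ℤ._≟_

infixr 8 _^_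
_^_ : Term → ℕ → Term
t ^ zero  = one
t ^ suc k = mul t (t ^ k)

module ΓL (u : L) where
  open Γ lex-ord u public using (max; min; ops; InΓ)
  open Algebra ops public using (_·ₐ_; _⇒ₐ_)

  max-cases : ∀ x y → (max x y ≡ y × x ≼ y) ⊎ (max x y ≡ x × y ≼ x)
  max-cases x y with x ≤ᴸ y in x≤y
  ... | true  = inj₁ (refl , ≤ᴸ⇒≼ (subst T (sym x≤y) _))
  ... | false = inj₂ (refl , ≰ᴸ⇒≽ (subst T x≤y))

  min-cases : ∀ x y → (min x y ≡ x × x ≼ y) ⊎ (min x y ≡ y × y ≼ x)
  min-cases x y with x ≤ᴸ y in x≤y
  ... | true  = inj₁ (refl , ≤ᴸ⇒≼ (subst T (sym x≤y) _))
  ... | false = inj₂ (refl , ≰ᴸ⇒≽ (subst T x≤y))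

  max-≼ : ∀ {x y} → x ≼ y → max x y ≡ y
  max-≼ {x} {y} x≼y with max-cases x y
  ... | inj₁ (eq , _)   = eq
  ... | inj₂ (eq , y≼x) = trans eq (≼-antisym x≼y y≼x)

  max-≽ : ∀ {x y} → y ≼ x → max x y ≡ x
  max-≽ {x} {y} y≼x with max-cases x y
  ... | inj₁ (eq , x≼y) = trans eq (≼-antisym y≼x x≼y)
  ... | inj₂ (eq , _)   = eq

  min-≼ : ∀ {x y} → x ≼ y → min x y ≡ x
  min-≼ {x} {y} x≼y with min-cases x y
  ... | inj₁ (eq , _)   = eq
  ... | inj₂ (eq , y≼x) = trans eq (≼-antisym y≼x x≼y)

  infix 30 _⁺
  _⁺ : L → L
  x ⁺ = max x 0L

  ⁺-nonneg : ∀ x → 0L ≼ x ⁺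
  ⁺-nonneg x with max-cases x 0L
  ... | inj₁ (eq , _)   = subst (0L ≼_) (sym eq) ≼-refl
  ... | inj₂ (eq , 0≼x) = subst (0L ≼_) (sym eq) 0≼x

  ⁺≢0⇒≡ : ∀ {x} → x ⁺ ≢ 0L → x ⁺ ≡ x
  ⁺≢0⇒≡ {x} x⁺≢0 with ≼-total 0L x
  ... | inj₁ 0≼x = max-≽ 0≼x
  ... | inj₂ x≼0 = ⊥-elim (x⁺≢0 (max-≼ x≼0))

  Bounded : L → Set
  Bounded a = 0L ≼ a × a ≼ u

  InΓ⇔Bounded : ∀ a → InΓ a ⇔ Bounded a
  InΓ⇔Bounded a = mk⇔
    (λ a∈Γ → let 0≤a , a≤u = Equivalence.to T-∧ a∈Γ in ≤ᴸ⇒≼ 0≤a , ≤ᴸ⇒≼ a≤u)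
    (λ { (0≼a , a≼u) → Equivalence.from T-∧ (≼⇒≤ᴸ 0≼a , ≼⇒≤ᴸ a≼u) })

  ·-bounded : ∀ {a b} → 0L ≼ u → Bounded a → Bounded b → Bounded (a ·ₐ b)
  ·-bounded {a} {b} 0≼u (_ , a≼u) (_ , b≼u) with max-cases ((a +L b) -L u) 0L
  ... | inj₁ (eq , _)   = subst Bounded (sym eq) (≼-refl , 0≼u)
  ... | inj₂ (eq , 0≼s) = subst Bounded (sym eq) (0≼s , ≼-trans s≼a a≼u)
    where
    s≼a : (a +L b) -L u ≼ a
    s≼a = subst ((a +L b) -L u ≼_) ([p+q]-q≡p a u)
            (+L-mono-≼ (+L-mono-≼ (≼-refl {a}) b≼u) (≼-refl {ℤ.- proj₁ u , ℤ.- proj₂ u}))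

  ⇒-bounded : ∀ {a b} → 0L ≼ u → Bounded a → Bounded b → Bounded (a ⇒ₐ b)
  ⇒-bounded {a} {b} 0≼u (_ , a≼u) (0≼b , _) with min-cases ((u -L a) +L b) u
  ... | inj₁ (eq , s≼u) = subst Bounded (sym eq) (+L-mono-≼ (≼⇒0≼- a≼u) 0≼b , s≼u)
  ... | inj₂ (eq , _)   = subst Bounded (sym eq) (0≼u , ≼-refl)

  eval-bounded : 0L ≼ u → ∀ v → (∀ x → Bounded (v x)) → ∀ t → Bounded (eval ops v t)
  eval-bounded 0≼u v v-bd (var x) = v-bd x
  eval-bounded 0≼u v v-bd one = 0≼u , ≼-refl
  eval-bounded 0≼u v v-bd (join s t) with max-cases (eval ops v s) (eval ops v t)
  ... | inj₁ (eq , _) = subst Bounded (sym eq) (eval-bounded 0≼u v v-bd t)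
  ... | inj₂ (eq , _) = subst Bounded (sym eq) (eval-bounded 0≼u v v-bd s)
  eval-bounded 0≼u v v-bd (meet s t) with min-cases (eval ops v s) (eval ops v t)
  ... | inj₁ (eq , _) = subst Bounded (sym eq) (eval-bounded 0≼u v v-bd s)
  ... | inj₂ (eq , _) = subst Bounded (sym eq) (eval-bounded 0≼u v v-bd t)
  eval-bounded 0≼u v v-bd (mul s t) =
    ·-bounded 0≼u (eval-bounded 0≼u v v-bd s) (eval-bounded 0≼u v v-bd t)
  eval-bounded 0≼u v v-bd (imp s t) =
    ⇒-bounded 0≼u (eval-bounded 0≼u v v-bd s) (eval-bounded 0≼u v v-bd t)

  pow : L → ℕ → L
  pow a k = (u -L k ·L (u -L a)) ⁺

  pow-of-u-c : ∀ c k → pow (u -L c) k ≡ (u -L k ·L c) ⁺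
  pow-of-u-c c k = cong (λ x → (u -L k ·L x) ⁺) (p-[p-q]≡q u c)

  ·-zero : ∀ {a} → a ≼ u → a ·ₐ 0L ≡ 0L
  ·-zero {a} a≼u = max-≼ (≼⇒-≼0 (subst (_≼ u) (sym (+L-identityʳ a)) a≼u))

  ·-pow : ∀ {a} → a ≼ u → ∀ k → a ·ₐ pow a k ≡ pow a (suc k)
  ·-pow {a} a≼u k with ≼-total 0L (u -L k ·L (u -L a))
  ... | inj₁ 0≼P = begin
    a ·ₐ pow a k                         ≡⟨ cong (a ·ₐ_) (max-≽ 0≼P) ⟩
    ((a +L (u -L k ·L (u -L a))) -L u) ⁺ ≡⟨ cong _⁺ ([a+[u-kc]]-u≡u-[k+1]c u a k) ⟩
    pow a (suc k)                        ∎
  ... | inj₂ P≼0 = begin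
    a ·ₐ pow a k  ≡⟨ cong (a ·ₐ_) (max-≼ P≼0) ⟩
    a ·ₐ 0L       ≡⟨ ·-zero a≼u ⟩
    0L            ≡⟨ max-≼ P'≼0 ⟨
    pow a (suc k) ∎
    where
    P'≼0 : u -L suc k ·L (u -L a) ≼ 0L
    P'≼0 = subst (_≼ 0L) (sym (u-[k+1]c≡u-kc-c u k (u -L a))) (≼-trans (p-c≼p _ (≼⇒0≼- a≼u)) P≼0)

  eval-^ : 0L ≼ u → ∀ {v t a} → eval ops v t ≡ a → a ≼ u → ∀ k → eval ops v (t ^ k) ≡ pow a k
  -- In the base case pow a 0 is (u -L 0L) ⁺ by computation: + 0 ℤ.* c reduces to + 0.
  eval-^ 0≼u t↦a a≼u zero    = sym (trans (cong _⁺ (-L-identityʳ u)) (max-≽ 0≼u))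
  eval-^ 0≼u t↦a a≼u (suc k) = trans (cong₂ _·ₐ_ t↦a (eval-^ 0≼u t↦a a≼u k)) (·-pow a≼u k)

  ⁺-drop⇒0 : ∀ x {c} → 0L ≼ c → c ≢ 0L → (x -L c) ⁺ ≡ x ⁺ → x ⁺ ≡ 0L
  ⁺-drop⇒0 x {c} 0≼c c≢0 eq with ≼-total 0L (x -L c)
  ... | inj₂ x-c≼0 = trans (sym eq) (max-≼ x-c≼0)
  ... | inj₁ 0≼x-c = ⊥-elim (c≢0 c≡0)
    where
    x-c≡x : x -L c ≡ x
    x-c≡x = trans (sym (max-≽ 0≼x-c)) (trans eq (max-≽ (≼-trans 0≼x-c (p-c≼p x 0≼c))))
    c≡0 : c ≡ 0L
    c≡0 = trans (sym (p-[p-q]≡q x c)) (trans (cong (x -L_) x-c≡x) (p-p≡0 x))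

  pow-stable⇒0 : ∀ {a} → a ≼ u → u -L a ≢ 0L → ∀ k → pow a (suc k) ≡ pow a k → pow a k ≡ 0L
  pow-stable⇒0 {a} a≼u c≢0 k eq =
    ⁺-drop⇒0 (u -L k ·L (u -L a)) (≼⇒0≼- a≼u) c≢0
      (trans (cong _⁺ (sym (u-[k+1]c≡u-kc-c u k (u -L a)))) eq)

  pow-const : ∀ {a} → u -L a ≡ 0L → ∀ k → pow a k ≡ (u -L 0L) ⁺
  pow-const c≡0 k = trans (cong (λ c → (u -L k ·L c) ⁺) c≡0) (cong (λ x → (u -L x) ⁺) (·L-zeroʳ k))

  ⇒-0 : ∀ {y} → 0L ≼ y → y ⇒ₐ 0L ≡ u -L y
  ⇒-0 {y} 0≼y =
    trans (min-≼ (subst (_≼ u) (sym (+L-identityʳ (u -L y))) (p-c≼p u 0≼y))) (+L-identityʳ (u -L y))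

  ⇒-refl : ∀ x → x ⇒ₐ x ≡ u
  ⇒-refl x = trans (cong (λ y → min y u) ([p-q]+q≡p u x)) (min-≼ ≼-refl)

  u-cancel : ∀ {x y} → u -L x ≡ u -L y → x ≡ y
  u-cancel {x} {y} eq = trans (sym (p-[p-q]≡q u x)) (trans (cong (u -L_) eq) (p-[p-q]≡q u y))

  part-analysis : ∀ n {a} → a ≼ u →
    pow a (suc (suc n)) ≡ pow a (suc n) → pow a n ⇒ₐ pow a (suc n) ≡ a →
    a ≡ u ⊎ u ≡ suc n ·L (u -L a)
  part-analysis n {a} a≼u e₁ e₂ with (u -L a) ≟L 0L
  ... | yes c≡0 = inj₁ (u-cancel (trans c≡0 (sym (p-p≡0 u))))
  ... | no  c≢0 = inj₂ (u-kc≡c⇒u≡[k+1]c u n (u -L a) (trans (sym (⁺≢0⇒≡ powₙ≢0)) powₙ≡c))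
    where
    powₙ≡c : pow a n ≡ u -L a
    powₙ≡c = u-cancel (begin
      u -L pow a n              ≡⟨ ⇒-0 (⁺-nonneg (u -L n ·L (u -L a))) ⟨
      pow a n ⇒ₐ 0L             ≡⟨ cong (pow a n ⇒ₐ_) (pow-stable⇒0 a≼u c≢0 (suc n) e₁) ⟨
      pow a n ⇒ₐ pow a (suc n)  ≡⟨ e₂ ⟩
      a                         ≡⟨ p-[p-q]≡q u a ⟨
      u -L (u -L a)             ∎)
    powₙ≢0 : pow a n ≢ 0L
    powₙ≢0 powₙ≡0 = c≢0 (trans (sym powₙ≡c) powₙ≡0)

  infinitesimal-bound : ∀ {g} N → g ≢ 0L →
    pow (u -L g) N ⇒ₐ pow (u -L g) (suc N) ≡ u -L g → suc N ·L g ≼ u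
  infinitesimal-bound {g} N g≢0 e₂ with ≼-total 0L (u -L suc N ·L g)
  ... | inj₁ 0≼u-Ng = 0≼-⇒≼ 0≼u-Ng
  ... | inj₂ u-Ng≼0 =
    subst (suc N ·L g ≼_) (sym (u-kc≡c⇒u≡[k+1]c u N g (trans (sym (⁺≢0⇒≡ powN≢0)) powN≡g))) ≼-refl
    where
    powN≡g : (u -L N ·L g) ⁺ ≡ g
    powN≡g = u-cancel (begin
      u -L (u -L N ·L g) ⁺                          ≡⟨ ⇒-0 (⁺-nonneg (u -L N ·L g)) ⟨
      (u -L N ·L g) ⁺ ⇒ₐ 0L                         ≡⟨ cong ((u -L N ·L g) ⁺ ⇒ₐ_) (max-≼ u-Ng≼0) ⟨
      (u -L N ·L g) ⁺ ⇒ₐ (u -L suc N ·L g) ⁺        ≡⟨ cong₂ _⇒ₐ_ (pow-of-u-c g N) (pow-of-u-c g (suc N)) ⟨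
      pow (u -L g) N ⇒ₐ pow (u -L g) (suc N)        ≡⟨ e₂ ⟩
      u -L g                                        ∎)
    powN≢0 : (u -L N ·L g) ⁺ ≢ 0L
    powN≢0 powN≡0 = g≢0 (trans (sym powN≡g) powN≡0)

  residue-split : ∀ {e g} N → e ≡ u -L g → pow e N ⇒ₐ pow e (suc N) ≡ e →
    e ≡ u ⊎ (g ≢ 0L × suc N ·L g ≼ u)
  residue-split {g = g} N refl e₂ with g ≟L 0L
  ... | yes refl = inj₁ (-L-identityʳ u)
  ... | no  g≢0  = inj₂ (g≢0 , infinitesimal-bound N g≢0 e₂)

  δ-value : L → ℕ → L
  δ-value a j = pow a j ⇒ₐ pow a (suc j)

  SmallResidue : ℕ → ℕ → L → L → Set
  SmallResidue j N a g = g ≢ 0L × suc N ·L g ≼ u × u ≡ g +L j ·L (u -L a)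

  residue-analysis : ∀ j N {a} → a ≼ u →
    pow a (suc (suc j)) ≡ pow a (suc j) →
    pow (δ-value a j) N ⇒ₐ pow (δ-value a j) (suc N) ≡ δ-value a j →
    δ-value a j ≡ u ⊎ SmallResidue j N a (pow a j)
  residue-analysis j N {a} a≼u e₁ e₂ = cases ((u -L a) ≟L 0L)
    where
    cases : Dec (u -L a ≡ 0L) → δ-value a j ≡ u ⊎ SmallResidue j N a (pow a j)
    cases (yes c≡0) = inj₁ (trans (cong₂ _⇒ₐ_ (pow-const c≡0 j) (pow-const c≡0 (suc j))) (⇒-refl _))
    cases (no  c≢0) = Sum.map₂ (λ (g≢0 , bound) → g≢0 , bound , u≡g+jc g≢0) (residue-split N e≡u-g e₂)
      where
      e≡u-g : δ-value a j ≡ u -L pow a j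
      e≡u-g = trans (cong (pow a j ⇒ₐ_) (pow-stable⇒0 a≼u c≢0 (suc j) e₁))
                    (⇒-0 (⁺-nonneg (u -L j ·L (u -L a))))
      u≡g+jc : pow a j ≢ 0L → u ≡ pow a j +L j ·L (u -L a)
      u≡g+jc g≢0 = sym (trans (cong (_+L j ·L (u -L a)) (⁺≢0⇒≡ g≢0)) ([p-q]+q≡p u (j ·L (u -L a))))

  -L-bounded : ∀ {c} → 0L ≼ c → c ≼ u → Bounded (u -L c)
  -L-bounded {c} 0≼c c≼u = ≼⇒0≼- c≼u , p-c≼p u 0≼c

  u-c≢u : ∀ {c} → c ≢ 0L → u -L c ≢ u
  u-c≢u c≢0 u-c≡u = c≢0 (u-cancel (trans u-c≡u (sym (-L-identityʳ u))))

  pow-0⇒stable : ∀ {a} k → a ≼ u → pow a k ≡ 0L → pow a (suc k) ≡ pow a k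
  pow-0⇒stable {a} k a≼u powₖ≡0 =
    trans (sym (·-pow a≼u k)) (trans (cong (a ·ₐ_) powₖ≡0) (trans (·-zero a≼u) (sym powₖ≡0)))

  part-witness : ∀ n {c} → 0L ≼ c → u ≡ suc n ·L c →
    pow (u -L c) (suc (suc n)) ≡ pow (u -L c) (suc n) × pow (u -L c) n ⇒ₐ pow (u -L c) (suc n) ≡ u -L c
  part-witness n {c} 0≼c u≡ =
    pow-0⇒stable (suc n) a≼u powₙ₊₁≡0 ,
    trans (cong₂ _⇒ₐ_ powₙ≡c powₙ₊₁≡0) (⇒-0 0≼c)
    where
    a = u -L c
    a≼u : a ≼ u
    a≼u = p-c≼p u 0≼c
    powₙ₊₁≡0 : pow a (suc n) ≡ 0L
    powₙ₊₁≡0 = begin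
      pow a (suc n)                      ≡⟨ pow-of-u-c c (suc n) ⟩
      (u -L suc n ·L c) ⁺                ≡⟨ cong (λ x → (x -L suc n ·L c) ⁺) u≡ ⟩
      (suc n ·L c -L suc n ·L c) ⁺       ≡⟨ cong _⁺ (p-p≡0 (suc n ·L c)) ⟩
      0L ⁺                               ≡⟨ max-≼ ≼-refl ⟩
      0L                                 ∎
    powₙ≡c : pow a n ≡ c
    powₙ≡c = begin
      pow a n                  ≡⟨ pow-of-u-c c n ⟩
      (u -L n ·L c) ⁺          ≡⟨ cong (λ x → (x -L n ·L c) ⁺) u≡ ⟩
      (suc n ·L c -L n ·L c) ⁺ ≡⟨ cong _⁺ ([k+1]c-kc≡c n c) ⟩
      c ⁺                      ≡⟨ max-≽ 0≼c ⟩
      c                        ∎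

  residue-witness : ∀ j N {c g} → 0L ≼ g → g ≼ c → (∀ k → k ·L g ≼ u) → u ≡ g +L j ·L c →
    let a = u -L c in
    pow a (suc (suc j)) ≡ pow a (suc j) ×
    pow (δ-value a j) N ⇒ₐ pow (δ-value a j) (suc N) ≡ δ-value a j ×
    δ-value a j ≡ u -L g
  residue-witness j N {c} {g} 0≼g g≼c kg≼u u≡ =
    pow-0⇒stable (suc j) a≼u powⱼ₊₁≡0 ,
    (begin
      pow (δ-value a j) N ⇒ₐ pow (δ-value a j) (suc N) ≡⟨ cong₂ _⇒ₐ_ (pow-e N) (pow-e (suc N)) ⟩
      (u -L N ·L g) ⇒ₐ (u -L suc N ·L g)             ≡⟨ cong (λ x → min x u) ([u-[u-Ng]]+[u-[N+1]g]≡u-g u g N) ⟩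
      min (u -L g) u                                  ≡⟨ min-≼ (p-c≼p u 0≼g) ⟩
      u -L g                                          ≡⟨ e≡u-g ⟨
      δ-value a j                                     ∎) ,
    e≡u-g
    where
    a = u -L c
    a≼u : a ≼ u
    a≼u = p-c≼p u (≼-trans 0≼g g≼c)
    u-jc≡g : u -L j ·L c ≡ g
    u-jc≡g = trans (cong (_-L j ·L c) u≡) ([p+q]-q≡p g (j ·L c))
    powⱼ≡g : pow a j ≡ g
    powⱼ≡g = trans (pow-of-u-c c j) (trans (cong _⁺ u-jc≡g) (max-≽ 0≼g))
    powⱼ₊₁≡0 : pow a (suc j) ≡ 0L
    powⱼ₊₁≡0 = begin
      pow a (suc j)              ≡⟨ pow-of-u-c c (suc j) ⟩
      (u -L suc j ·L c) ⁺        ≡⟨ cong _⁺ (u-[k+1]c≡u-kc-c u j c) ⟩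
      ((u -L j ·L c) -L c) ⁺     ≡⟨ cong (λ x → (x -L c) ⁺) u-jc≡g ⟩
      (g -L c) ⁺                 ≡⟨ max-≼ (≼⇒-≼0 g≼c) ⟩
      0L                         ∎
    e≡u-g : δ-value a j ≡ u -L g
    e≡u-g = trans (cong₂ _⇒ₐ_ powⱼ≡g powⱼ₊₁≡0) (⇒-0 0≼g)
    pow-e : ∀ k → pow (δ-value a j) k ≡ u -L k ·L g
    pow-e k = trans (cong (λ x → pow x k) e≡u-g) (trans (pow-of-u-c g k) (max-≽ (≼⇒0≼- (kg≼u k))))

-- Two separating quasi-identities

x₀ : Term
x₀ = var 0

δ : ℕ → Term
δ j = imp (x₀ ^ j) (x₀ ^ suc j)

partQI : ℕ → QuasiIdentity
partQI n = ((x₀ ^ suc (suc n) , x₀ ^ suc n) ∷ (δ n , x₀) ∷ []) ⇒ (x₀ , one)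

residueQI : ℕ → ℕ → QuasiIdentity
residueQI j N = ((x₀ ^ suc (suc j) , x₀ ^ suc j) ∷ (imp (δ j ^ N) (δ j ^ suc N) , δ j) ∷ []) ⇒ (δ j , one)

module QuasiIdentitiesInΓL (u : L) (0≼u : 0L ≼ u) where
  open ΓL u

  module _ (v : ℕ → L) (v-bd : ∀ x → Bounded (v x)) where

    eval-x₀^ : ∀ k → eval ops v (x₀ ^ k) ≡ pow (v 0) k
    eval-x₀^ = eval-^ 0≼u refl (proj₂ (v-bd 0))

    eval-δ : ∀ j → eval ops v (δ j) ≡ δ-value (v 0) j
    eval-δ j = cong₂ _⇒ₐ_ (eval-x₀^ j) (eval-x₀^ (suc j))

    eval-δ^ : ∀ j k → eval ops v (δ j ^ k) ≡ pow (δ-value (v 0) j) k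
    eval-δ^ j = eval-^ 0≼u (eval-δ j)
      (subst (_≼ u) (eval-δ j) (proj₂ (eval-bounded 0≼u v v-bd (δ j))))

    partQI-premises : ∀ n → All (Satisfies ops v) (QuasiIdentity.premises (partQI n)) →
      v 0 ≡ u ⊎ u ≡ suc n ·L (u -L v 0)
    partQI-premises n (e₁ ∷ e₂ ∷ []) = part-analysis n (proj₂ (v-bd 0))
      (trans (sym (eval-x₀^ (suc (suc n)))) (trans e₁ (eval-x₀^ (suc n))))
      (trans (sym (eval-δ n)) e₂)

    residueQI-premises : ∀ j N → All (Satisfies ops v) (QuasiIdentity.premises (residueQI j N)) →
      eval ops v (δ j) ≡ u ⊎ SmallResidue j N (v 0) (eval ops v (x₀ ^ j))
    residueQI-premises j N (e₁ ∷ e₂ ∷ []) =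
      Sum.map (trans (eval-δ j)) (subst (SmallResidue j N (v 0)) (sym (eval-x₀^ j)))
        (residue-analysis j N (proj₂ (v-bd 0))
          (trans (sym (eval-x₀^ (suc (suc j)))) (trans e₁ (eval-x₀^ (suc j))))
          (trans (sym (cong₂ _⇒ₐ_ (eval-δ^ j N) (eval-δ^ j (suc N)))) (trans e₂ (eval-δ j))))

  partQI-fails : ∀ n {c} → 0L ≼ c → c ≢ 0L → c ≼ u → u ≡ suc n ·L c →
                 ¬ Holds ops (λ _ → u -L c) (partQI n)
  partQI-fails n 0≼c c≢0 c≼u u≡ holds = u-c≢u c≢0 (holds
    ( trans (eval-x₀^ v v-bd (suc (suc n))) (trans (proj₁ witness) (sym (eval-x₀^ v v-bd (suc n))))
    ∷ trans (eval-δ v v-bd n) (proj₂ witness)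
    ∷ []))
    where
    v = λ _ → u -L _
    v-bd = λ _ → -L-bounded 0≼c c≼u
    witness = part-witness n 0≼c u≡

  residueQI-fails : ∀ j N {c g} → 0L ≼ g → g ≢ 0L → g ≼ c → c ≼ u → (∀ k → k ·L g ≼ u) →
                    u ≡ g +L j ·L c → ¬ Holds ops (λ _ → u -L c) (residueQI j N)
  residueQI-fails j N 0≼g g≢0 g≼c c≼u kg≼u u≡ holds =
    u-c≢u g≢0 (trans (sym (trans (eval-δ v v-bd j) e≡u-g)) (holds
      ( trans (eval-x₀^ v v-bd (suc (suc j))) (trans e₁ (sym (eval-x₀^ v v-bd (suc j))))
      ∷ trans (cong₂ _⇒ₐ_ (eval-δ^ v v-bd j N) (eval-δ^ v v-bd j (suc N))) (trans e₂ (sym (eval-δ v v-bd j)))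
      ∷ [])))
    where
    v = λ _ → u -L _
    v-bd = λ _ → -L-bounded (≼-trans 0≼g g≼c) c≼u
    witness = residue-witness j N 0≼g g≼c kg≼u u≡
    e₁ = proj₁ witness
    e₂ = proj₁ (proj₂ witness)
    e≡u-g = proj₂ (proj₂ witness)

-- The generators as algebras

module ΓAlgebra (𝔾 : OrdGroup) (u : OrdGroup.G 𝔾) where
  open OrdGroup 𝔾
  open Γ 𝔾 u

  Closed : Set
  Closed = ∀ v t → (∀ x → InΓ (v x)) → InΓ (eval ops v t)

  module _ (u∈Γ : InΓ u) (closed : Closed) where

    Elem : Set
    Elem = Σ G InΓ

    -- Each operation is the evaluation of a two-variable term, so `closed` covers all of them.
    lift₂ : (Term → Term → Term) → Elem → Elem → Elem
    lift₂ f (a , a∈Γ) (b , b∈Γ) = eval ops ab (f (var 0) (var 1)) , closed ab (f (var 0) (var 1)) ab∈Γ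
      where
      ab : ℕ → G
      ab zero    = a
      ab (suc _) = b
      ab∈Γ : ∀ x → InΓ (ab x)
      ab∈Γ zero    = a∈Γ
      ab∈Γ (suc _) = b∈Γ

    algebra : Algebra
    algebra = record
      { Carrier = Elem
      ; _⊔ₐ_ = lift₂ join
      ; _⊓ₐ_ = lift₂ meet
      ; _·ₐ_ = lift₂ mul
      ; _⇒ₐ_ = lift₂ imp
      ; 1ₐ   = u , u∈Γ
      }

    inclusion : Embedding algebra ops
    inclusion = record
      { ⟦_⟧ = proj₁
      ; injective = λ eq → Σ-≡,≡→≡ (eq , T-irrelevant _ _)
      ; ⟦⊔⟧ = λ _ _ → refl
      ; ⟦⊓⟧ = λ _ _ → refl
      ; ⟦·⟧ = λ _ _ → refl
      ; ⟦⇒⟧ = λ _ _ → refl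
      ; ⟦1⟧ = refl
      }

    sat⇒⊨ : ∀ q → sat q → algebra ⊨ q
    sat⇒⊨ q sat w = Equivalence.from (holds-⟦⟧ inclusion w q) (sat (proj₁ ∘ w) (proj₂ ∘ w))

    ⊨⇒holds : ∀ q → algebra ⊨ q → ∀ v → (∀ x → InΓ (v x)) → Holds ops v q
    ⊨⇒holds q ⊨q v v∈Γ =
      Equivalence.to (holds-⟦⟧ inclusion (λ x → v x , v∈Γ x) q) (⊨q (λ x → v x , v∈Γ x))

module _ (u : L) (0≼u : 0L ≼ u) where
  open ΓL u
  open Equivalence

  u∈ΓL : InΓ u
  u∈ΓL = from (InΓ⇔Bounded u) (0≼u , ≼-refl)

  closedL : ΓAlgebra.Closed lex-ord u
  closedL v t v∈Γ = from (InΓ⇔Bounded _) (eval-bounded 0≼u v (λ x → to (InΓ⇔Bounded (v x)) (v∈Γ x)) t)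

module _ (i : ℕ) where
  open Equivalence

  ι-bounded : ∀ (w : ℕ → ℤ) → (∀ x → Γ.InΓ ℤ-ord (+ i) (w x)) →
              ∀ x → ΓL.Bounded (+ i , + 0) (w x , + 0)
  ι-bounded w w∈Γ x = to (ΓL.InΓ⇔Bounded (+ i , + 0) _) (to (InΓ-φ ι (+ i) (w x)) (w∈Γ x))

  u∈Γℤ : Γ.InΓ ℤ-ord (+ i) (+ i)
  u∈Γℤ = from (InΓ-φ ι (+ i) (+ i)) (u∈ΓL (+ i , + 0) (0≼+,+ i 0))

  closedℤ : ΓAlgebra.Closed ℤ-ord (+ i)
  closedℤ w t w∈Γ = from (InΓ-φ ι (+ i) (eval (Γ.ops ℤ-ord (+ i)) w t))
    (subst (Γ.InΓ lex-ord (+ i , + 0)) (sym (eval-⟦⟧ (Γ-embedding ι (+ i)) w t))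
      (closedL (+ i , + 0) (0≼+,+ i 0) (λ x → w x , + 0) t (λ x → to (InΓ-φ ι (+ i) (w x)) (w∈Γ x))))

Ł : ℕ → Algebra
Ł i = ΓAlgebra.algebra ℤ-ord (+ i) (u∈Γℤ i) (closedℤ i)

Ł1 : ℕ → Algebra
Ł1 j = ΓAlgebra.algebra lex-ord (+ j , + 1) (u∈ΓL (+ j , + 1) (0≼+,+ j 1))
                                            (closedL (+ j , + 1) (0≼+,+ j 1))

Ł-⊨⇒holds : ∀ i q → Ł i ⊨ q → ∀ w → (∀ x → Γ.InΓ ℤ-ord (+ i) (w x)) → Holds (Γ.ops ℤ-ord (+ i)) w q
Ł-⊨⇒holds i = ΓAlgebra.⊨⇒holds ℤ-ord (+ i) (u∈Γℤ i) (closedℤ i)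

Ł1-⊨⇒holds : ∀ j q → Ł1 j ⊨ q → ∀ v → (∀ x → Γ.InΓ lex-ord (+ j , + 1) (v x)) →
             Holds (Γ.ops lex-ord (+ j , + 1)) v q
Ł1-⊨⇒holds j = ΓAlgebra.⊨⇒holds lex-ord (+ j , + 1) (u∈ΓL (+ j , + 1) (0≼+,+ j 1))
                                                    (closedL (+ j , + 1) (0≼+,+ j 1))

Ł-sat⇒⊨ : ∀ i q → Ł-sat i q → Ł i ⊨ q
Ł-sat⇒⊨ i = ΓAlgebra.sat⇒⊨ ℤ-ord (+ i) (u∈Γℤ i) (closedℤ i)

Ł1-sat⇒⊨ : ∀ j q → Ł1-sat j q → Ł1 j ⊨ q
Ł1-sat⇒⊨ j = ΓAlgebra.sat⇒⊨ lex-ord (+ j , + 1) (u∈ΓL (+ j , + 1) (0≼+,+ j 1))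
                                                (closedL (+ j , + 1) (0≼+,+ j 1))

Ł∈Q : ∀ {I J i} → i ∈ I → Q[ I , J ] (Ł i)
Ł∈Q i∈I q (valid-I , _) = Ł-sat⇒⊨ _ q (All.lookup valid-I i∈I)

Ł1∈Q : ∀ {I J j} → j ∈ J → Q[ I , J ] (Ł1 j)
Ł1∈Q j∈J q (_ , valid-J) = Ł1-sat⇒⊨ _ q (All.lookup valid-J j∈J)

-- Necessity of the divisibility conditions

+≡+*⇒∣ : ∀ {n k c} → + n ≡ + k ℤ.* c → k ∣ n
+≡+*⇒∣ {k = k} {c} eq =
  divides ℤ.∣ c ∣ (trans (cong ℤ.∣_∣ eq) (trans (ℤP.abs-* (+ k) c) (ℕP.*-comm k ℤ.∣ c ∣)))

+[1+N]*x≰+n : ∀ {N n x} → + 0 ℤ.< x → n ℕ.≤ N → ¬ (+[1+ N ] ℤ.* x ℤ.≤ + n)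
+[1+N]*x≰+n {x = + zero} (+<+ ()) _ _
+[1+N]*x≰+n {N} {n} {+ suc x} _ n≤N Nx≤n with subst (ℤ._≤ + n) (sym (ℤP.pos-* (suc N) (suc x))) Nx≤n
... | +≤+ Nx≤n' = ℕP.<⇒≱ (s≤s n≤N) (ℕP.≤-trans (ℕP.m≤m*n (suc N) (suc x)) Nx≤n')

0≺ι⇒0< : ∀ {h} → 0L ≼ (h , + 0) → (h , + 0) ≢ 0L → + 0 ℤ.< h
0≺ι⇒0< (inj₁ 0<h)        _   = 0<h
0≺ι⇒0< (inj₂ (refl , _)) h≢0 = ⊥-elim (h≢0 refl)

Ł-sat-partQI : ∀ n {i'} → ¬ (suc n ∣ i') → Ł-sat i' (partQI n)
Ł-sat-partQI n {i'} n+1∤i' = sat-from-image ι (+ i') (partQI n) λ w w∈Γ prem →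
  Sum.[ id , (λ u≡ → ⊥-elim (n+1∤i' (+≡+*⇒∣ (cong proj₁ u≡)))) ]
    (partQI-premises (λ x → w x , + 0) (ι-bounded i' w w∈Γ) n prem)
  where open QuasiIdentitiesInΓL (+ i' , + 0) (0≼+,+ i' 0)

Ł1-sat-partQI : ∀ m {j'} → Ł1-sat j' (partQI (suc m))
Ł1-sat-partQI m {j'} v v∈Γ prem =
  Sum.[ id , (λ u≡ → ⊥-elim (m+2∤1 (+≡+*⇒∣ (cong proj₂ u≡)))) ]
    (partQI-premises v (λ x → Equivalence.to (InΓ⇔Bounded (v x)) (v∈Γ x)) (suc m) prem)
  where
  open ΓL (+ j' , + 1)
  open QuasiIdentitiesInΓL (+ j' , + 1) (0≼+,+ j' 1)
  m+2∤1 : ¬ (suc (suc m) ∣ 1)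
  m+2∤1 m+2∣1 with ∣1⇒≡1 m+2∣1
  ... | ()

Ł-sat-residueQI : ∀ j N {i'} → i' ℕ.≤ N → Ł-sat i' (residueQI j N)
Ł-sat-residueQI j N {i'} i'≤N = sat-from-image ι (+ i') (residueQI j N) λ w w∈Γ prem →
  Sum.[ id , ⊥-elim ∘ no-residue w w∈Γ ]
    (residueQI-premises (λ x → w x , + 0) (ι-bounded i' w w∈Γ) j N prem)
  where
  open ΓL (+ i' , + 0)
  open QuasiIdentitiesInΓL (+ i' , + 0) (0≼+,+ i' 0)
  no-residue : ∀ w w∈Γ → ¬ SmallResidue j N (w 0 , + 0) (eval ops (λ x → w x , + 0) (x₀ ^ j))
  no-residue w w∈Γ (g≢0 , bound , _) =
    +[1+N]*x≰+n (0≺ι⇒0< (subst (0L ≼_) g≡ι 0≼g) (subst (_≢ 0L) g≡ι g≢0)) i'≤N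
      (≼⇒fst≤ (subst (λ g → suc N ·L g ≼ (+ i' , + 0)) g≡ι bound))
    where
    g≡ι = sym (eval-⟦⟧ (Γ-embedding ι (+ i')) w (x₀ ^ j))
    0≼g = proj₁ (eval-bounded (0≼+,+ i' 0) (λ x → w x , + 0) (ι-bounded i' w w∈Γ) (x₀ ^ j))

Ł1-sat-residueQI : ∀ j N {j'} → j' ℕ.≤ N → ¬ (j ∣ j') → Ł1-sat j' (residueQI j N)
Ł1-sat-residueQI j N {j'} j'≤N j∤j' v v∈Γ prem =
  Sum.[ id , ⊥-elim ∘ no-residue (proj₁ (eval-bounded (0≼+,+ j' 1) v v-bd (x₀ ^ j))) ]
    (residueQI-premises v v-bd j N prem)
  where
  open ΓL (+ j' , + 1)
  open QuasiIdentitiesInΓL (+ j' , + 1) (0≼+,+ j' 1)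
  v-bd = λ x → Equivalence.to (InΓ⇔Bounded (v x)) (v∈Γ x)
  no-residue : ∀ {g} → 0L ≼ g → ¬ SmallResidue j N (v 0) g
  no-residue (inj₁ 0<g₁) (_ , bound , _) = +[1+N]*x≰+n 0<g₁ j'≤N (≼⇒fst≤ bound)
  no-residue (inj₂ (refl , _)) (_ , _ , u≡) =
    j∤j' (+≡+*⇒∣ (trans (cong proj₁ u≡) (ℤP.+-identityˡ _)))

Ł-fails-partQI : ∀ m → ¬ (Ł (suc (suc m)) ⊨ partQI (suc m))
Ł-fails-partQI m ⊨q = partQI-fails (suc m) {c} 0≼c (λ ()) c≼u u≡
  (Equivalence.to (holds-⟦⟧ (Γ-embedding ι (+ i)) w (partQI (suc m)))
    (Ł-⊨⇒holds (suc (suc m)) (partQI (suc m)) ⊨q w w∈Γ))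
  where
  i = suc (suc m)
  open ΓL (+ i , + 0)
  open QuasiIdentitiesInΓL (+ i , + 0) (0≼+,+ i 0)
  c = + 1 , + 0
  0≼c : 0L ≼ c
  0≼c = 0≼+,+ 1 0
  c≼u : c ≼ (+ i , + 0)
  c≼u = inj₁ (+<+ (s≤s (s≤s z≤n)))
  u≡ : (+ i , + 0) ≡ suc (suc m) ·L c
  u≡ = cong₂ _,_ (sym (ℤP.*-identityʳ (+ i))) (sym (ℤP.*-zeroʳ (+ i)))
  w : ℕ → ℤ
  w _ = + i ℤ.- + 1
  w∈Γ : ∀ x → Γ.InΓ ℤ-ord (+ i) (w x)
  w∈Γ _ = Equivalence.from (InΓ-φ ι (+ i) (w 0)) (Equivalence.from (InΓ⇔Bounded _) (-L-bounded 0≼c c≼u))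

Ł1-fails-residueQI : ∀ jm N → ¬ (Ł1 (suc jm) ⊨ residueQI (suc jm) N)
Ł1-fails-residueQI jm N ⊨q = residueQI-fails j N {c} {g} 0≼g (λ ()) g≼c c≼u kg≼u u≡
  (Ł1-⊨⇒holds (suc jm) (residueQI (suc jm) N) ⊨q
    (λ _ → u -L c) (λ _ → Equivalence.from (InΓ⇔Bounded _) (-L-bounded (0≼+,+ 1 0) c≼u)))
  where
  j = suc jm
  u = + j , + 1
  open ΓL u
  open QuasiIdentitiesInΓL u (0≼+,+ j 1)
  c g : L
  c = + 1 , + 0
  g = + 0 , + 1
  0≼g : 0L ≼ g
  0≼g = 0≼+,+ 0 1
  g≼c : g ≼ c
  g≼c = inj₁ (+<+ (s≤s z≤n))
  c≼u : c ≼ u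
  c≼u = ≤×≤⇒≼ (+≤+ (s≤s z≤n)) (+≤+ z≤n)
  kg≼u : ∀ k → k ·L g ≼ u
  kg≼u k = inj₁ (subst (ℤ._< + j) (sym (ℤP.*-zeroʳ (+ k))) (+<+ (s≤s z≤n)))
  u≡ : u ≡ g +L j ·L c
  u≡ = cong₂ _,_ (sym (trans (ℤP.+-identityˡ _) (ℤP.*-identityʳ (+ j))))
                 (sym (cong (λ x → + 1 ℤ.+ x) (ℤP.*-zeroʳ (+ j))))

∈⇒≤sum : ∀ {n ns} → n ∈ ns → n ℕ.≤ sum ns
∈⇒≤sum {ns = n ∷ ns} (here refl)  = ℕP.m≤m+n n (sum ns)
∈⇒≤sum {ns = m ∷ ns} (there n∈ns) = ℕP.≤-trans (∈⇒≤sum n∈ns) (ℕP.m≤n+m (sum ns) m)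

module _ {I J I' J'} (⊆ : Q[ I , J ] ⊆Q Q[ I' , J' ]) where

  ⊆Q⇒∣I : All (0 <_) I → (i : ℕ) → i ∈ I → i ≢ 1 → Σ ℕ (λ i' → i' ∈ I' × i ∣ i')
  ⊆Q⇒∣I 0<I i i∈I i≢1 with any? (i ∣?_) I'
  ... | yes i∣some = find i∣some
  ... | no  i∤all  = ⊥-elim (refute i (All.lookup 0<I i∈I) i≢1 i∈I (¬Any⇒All¬ I' i∤all))
    where
    refute : ∀ i → 0 < i → i ≢ 1 → i ∈ I → All (λ i' → ¬ i ∣ i') I' → ⊥
    refute (suc zero)    _ i≢1 _   _    = i≢1 refl
    refute (suc (suc m)) _ _   i∈I i∤I' =
      Ł-fails-partQI m (⊆ (Ł (suc (suc m))) (Ł∈Q i∈I) (partQI (suc m))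
        (All.map (Ł-sat-partQI (suc m)) i∤I' , All.tabulate (λ _ → Ł1-sat-partQI m)))

  ⊆Q⇒∣J : All (0 <_) J → (j : ℕ) → j ∈ J → Σ ℕ (λ j' → j' ∈ J' × j ∣ j')
  ⊆Q⇒∣J 0<J j j∈J with any? (j ∣?_) J'
  ... | yes j∣some = find j∣some
  ... | no  j∤all  = ⊥-elim (refute j (All.lookup 0<J j∈J) j∈J (¬Any⇒All¬ J' j∤all))
    where
    N = sum I' ℕ.+ sum J'
    refute : ∀ j → 0 < j → j ∈ J → All (λ j' → ¬ j ∣ j') J' → ⊥
    refute (suc jm) _ j∈J j∤J' = Ł1-fails-residueQI jm N (⊆ (Ł1 (suc jm)) (Ł1∈Q j∈J) (residueQI (suc jm) N)
      ( All.tabulate (λ i'∈I' → Ł-sat-residueQI _ N (ℕP.≤-trans (∈⇒≤sum i'∈I') (ℕP.m≤m+n _ _)))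
      , All.tabulate (λ j'∈J' → Ł1-sat-residueQI _ N (ℕP.≤-trans (∈⇒≤sum j'∈J') (ℕP.m≤n+m _ _))
                                                   (All.lookup j∤J' j'∈J'))))

lemma4p12 : (I J I' J' : List ℕ) →
    All (0 <_) I → All (0 <_) J → All (0 <_) I' → All (0 <_) J' →
    J ≢ [] → J' ≢ [] →
    (Q[ I , J ] ⊆Q Q[ I' , J' ]) ⇔
      (((i : ℕ) → i ∈ I → i ≢ 1 → Σ ℕ (λ i' → i' ∈ I' × i ∣ i')) ×
       ((j : ℕ) → j ∈ J → Σ ℕ (λ j' → j' ∈ J' × j ∣ j')))
lemma4p12 I J I' J' 0<I 0<J 0<I' 0<J' _ J'≢[] = mk⇔
  (λ ⊆ → ⊆Q⇒∣I ⊆ 0<I , ⊆Q⇒∣J ⊆ 0<J)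
  (λ (I∣I' , J∣J') → divisibility⇒⊆Q I J I' J' 0<I' 0<J' J'≢[] I∣I' J∣J')
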